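{- Let $\beta:\mathrm{FinTree}\to(\mathrm{Sequent}\times\mathrm{RulName})\times\mathrm{FinTree}^*$ be an infinitary proof translation and let $\pi$ be a finite proof in $\mathrm{i}\mathsf{GL}_{\mathrm{Seq}}$. (a) If $s=(s_0,\dots,s_{k-1})$ is a node of $\mathrm{trans}_\beta(\pi)$, then there is a finite sequence $(\iota_n)_{n\le k}$ of finite proofs in $\mathrm{i}\mathsf{GL}_{\mathrm{Seq}}$ such that for every $n\le k$, $\mathrm{subtree}_{s\restriction n}(\mathrm{trans}_\beta(\pi))=\mathrm{trans}_\beta(\iota_n)$, and for every $n<k$, $\iota_{n+1}$ is the $s_n$-th element of the list component of $\beta(\iota_n)$. (b) If $s\in\omega^\omega$ is a branch of $\mathrm{trans}_\beta(\pi)$, then there is an infinite sequence $(\iota_n)_{n<\omega}$ of finite proofs in $\mathrm{i}\mathsf{GL}_{\mathrm{Seq}}$ such that for every $n$, $\mathrm{subtree}_{s\restriction n}(\mathrm{trans}_\beta(\pi))=\mathrm{trans}_\beta(\iota_n)$ and $\iota_{n+1}$ is the $s_n$-th element of the list component of $\beta(\iota_n)$.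
   Context: Formulas are built from propositional variables and $\bot$ with $\to,\wedge,\vee,\Box$; a sequent $\Gamma\Rightarrow\phi$ is a finite multiset $\Gamma$ of formulas and one formula $\phi$; $\Box\Gamma=\{\Box\psi:\psi\in\Gamma\}$. RulName is a set of rule names. The rule set $\mathrm{i}\mathsf{G3}$: Prop: $\Gamma,p\Rightarrow p$; Absurd: $\Gamma,\bot\Rightarrow\phi$; $(\wedge L)$: $\Gamma,\phi,\psi\Rightarrow\chi$ / $\Gamma,\phi\wedge\psi\Rightarrow\chi$; $(\wedge R)$: $\Gamma\Rightarrow\phi$, $\Gamma\Rightarrow\psi$ / $\Gamma\Rightarrow\phi\wedge\psi$; $(\vee L)$: $\Gamma,\phi\Rightarrow\chi$, $\Gamma,\psi\Rightarrow\chi$ / $\Gamma,\phi\vee\psi\Rightarrow\chi$; $(\vee R_0)$: $\Gamma\Rightarrow\phi$ / $\Gamma\Rightarrow\phi\vee\psi$; $(\vee R_1)$: $\Gamma\Rightarrow\psi$ / $\Gamma\Rightarrow\phi\vee\psi$; $(\to L)$: $\Gamma,\phi\to\psi\Rightarrow\phi$, $\Gamma,\psi\Rightarrow\chi$ / $\Gamma,\phi\to\psi\Rightarrow\chi$; $(\to R)$: $\Gamma,\phi\Rightarrow\psi$ / $\Gamma\Rightarrow\phi\to\psi$. $\mathrm{i}\mathsf{GL}_{\mathrm{Seq}}=\mathrm{i}\mathsf{G3}+\mathrm{R}_{\mathsf{GL}}$ where $\mathrm{R}_{\mathsf{GL}}$: $\Gamma,\Box\Gamma,\Box\phi\Rightarrow\phi$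 / $\Pi,\Box\Gamma\Rightarrow\Box\phi$; $\mathrm{i}\mathsf{K4}_{\mathrm{Seq}}=\mathrm{i}\mathsf{G3}+\mathrm{R}_{\mathsf{K4}}$ where $\mathrm{R}_{\mathsf{K4}}$: $\Gamma,\Box\Gamma\Rightarrow\phi$ / $\Pi,\Box\Gamma\Rightarrow\Box\phi$. Tree denotes the set of (possibly infinite) finitely branching rooted trees with ordered children and node labels in $\mathrm{Sequent}\times\mathrm{RulName}$ (formally, the final coalgebra of $X\mapsto(\mathrm{Sequent}\times\mathrm{RulName})\times X^*$); FinTree is the set of finite ones. For a label $a$ and a list of trees $[t_0,\dots,t_{n-1}]$, $\mathrm{node}(a,[t_0,\dots,t_{n-1}])$ is the tree with root label $a$ and ordered immediate subtrees $t_0,\dots,t_{n-1}$. Nodes of a tree $t$ are finite sequences of natural numbers: the empty sequence is the root, and $i$ prepended to $s$ is a node iff the root has an $i$-th child (0-indexed) $t_i$ and $s$ is a node of $t_i$; $\mathrm{subtree}_s(t)$ is the subtree rooted at node $s$. A branch is an $s\in\omega^\omega$ all of whose finite initial segments $s\restriction n$ are nodes. A finite proof in a rule set $R$ is a finite tree in which at each node, (the list of children's sequents, the node's sequent, the node's rule name) is an instance of a rule of $R$. The height of a finite tree is the maximal length of its nodes. An infinitary proof translation is a function $\beta:\mathrm{FinTree}\to(\mathrm{Sequent}\times\mathrm{RulName})\times\mathrm{FinTree}^*$ such that for every finite proof $\pi$ in $\mathrm{i}\mathsf{GL}_{\mathrm{Seq}}$, writing $\beta(\pi)=((S,L),[\iota_0,\dots,\iota_{n-1}])$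 and letting $(S_i,L_i)$ be the first component of $\beta(\iota_i)$: (1) each $\iota_i$ is a finite proof in $\mathrm{i}\mathsf{GL}_{\mathrm{Seq}}$; (2) $S_0,\dots,S_{n-1}$ / $S$ with name $L$ is an instance of a rule of $\mathrm{i}\mathsf{K4}_{\mathrm{Seq}}$; (3) if $L\neq\mathrm{R}_{\mathsf{K4}}$ then $\mathrm{height}(\iota_i)<\mathrm{height}(\pi)$ for all $i<n$. Given such $\beta$, $\mathrm{trans}_\beta:\mathrm{FinTree}\to\mathrm{Tree}$ is the unique function with $\mathrm{trans}_\beta(t)=\mathrm{node}(a,[\mathrm{trans}_\beta(t_0),\dots,\mathrm{trans}_\beta(t_{n-1})])$ whenever $\beta(t)=(a,[t_0,\dots,t_{n-1}])$. -}

module Defs where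

open import Data.Nat using (ℕ; zero; suc; _<_; _⊔_)
open import Data.Product using (_×_; _,_; proj₁; proj₂; Σ; ∃)
open import Data.List using (List; []; _∷_; _++_; map; [_])
open import Data.List.Relation.Unary.All using (All)
open import Data.List.Relation.Binary.Pointwise using (Pointwise)
open import Data.List.Relation.Binary.Permutation.Propositional using (_↭_)
open import Data.Maybe using (Maybe; just; nothing; maybe)
open import Relation.Binary.PropositionalEquality using (_≡_; _≢_)

infixr 6 _⇒'_
infixr 7 _∨'_
infixr 8 _∧'_

data Formula : Set where
  var  : ℕ → Formula
  ⊥'   : Formula
  _⇒'_ : Formula → Formula → Formula
  _∧'_ : Formula → Formula → Formula
  _∨'_ : Formula → Formula → Formula
  □    : Formula → Formula

-- A sequent Γ ⇒ φ.  The finite multiset Γ is represented by a list;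
-- rule instances are taken up to permutation of antecedents (see Inst).
record Sequent : Set where
  constructor _⊢_
  field
    ctx  : List Formula
    succ : Formula
open Sequent public

□L : List Formula → List Formula
□L = map □

data RulName : Set where
  Prop Absurd ∧L ∧R ∨L ∨R₀ ∨R₁ →L →R RGL RK4 : RulName

data G3 : List Sequent → Sequent → RulName → Set where
  prop   : ∀ Γ p → G3 [] ((var p ∷ Γ) ⊢ var p) Prop
  absurd : ∀ Γ φ → G3 [] ((⊥' ∷ Γ) ⊢ φ) Absurd
  ∧l : ∀ Γ φ ψ χ → G3 [ (φ ∷ ψ ∷ Γ) ⊢ χ ] (((φ ∧' ψ) ∷ Γ) ⊢ χ) ∧L
  ∧r : ∀ Γ φ ψ → G3 ((Γ ⊢ φ) ∷ (Γ ⊢ ψ) ∷ []) (Γ ⊢ (φ ∧' ψ)) ∧R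
  ∨l : ∀ Γ φ ψ χ → G3 (((φ ∷ Γ) ⊢ χ) ∷ ((ψ ∷ Γ) ⊢ χ) ∷ []) (((φ ∨' ψ) ∷ Γ) ⊢ χ) ∨L
  ∨r₀ : ∀ Γ φ ψ → G3 [ Γ ⊢ φ ] (Γ ⊢ (φ ∨' ψ)) ∨R₀
  ∨r₁ : ∀ Γ φ ψ → G3 [ Γ ⊢ ψ ] (Γ ⊢ (φ ∨' ψ)) ∨R₁
  →l : ∀ Γ φ ψ χ → G3 ((((φ ⇒' ψ) ∷ Γ) ⊢ φ) ∷ ((ψ ∷ Γ) ⊢ χ) ∷ []) (((φ ⇒' ψ) ∷ Γ) ⊢ χ) →L
  →r : ∀ Γ φ ψ → G3 [ (φ ∷ Γ) ⊢ ψ ] (Γ ⊢ (φ ⇒' ψ)) →R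

data GL₀ : List Sequent → Sequent → RulName → Set where
  g3  : ∀ {ps c L} → G3 ps c L → GL₀ ps c L
  rgl : ∀ Π Γ φ → GL₀ [ (Γ ++ □L Γ ++ [ □ φ ]) ⊢ φ ] ((Π ++ □L Γ) ⊢ □ φ) RGL

data K4₀ : List Sequent → Sequent → RulName → Set where
  g3  : ∀ {ps c L} → G3 ps c L → K4₀ ps c L
  rk4 : ∀ Π Γ φ → K4₀ [ (Γ ++ □L Γ) ⊢ φ ] ((Π ++ □L Γ) ⊢ □ φ) RK4

_≈S_ : Sequent → Sequent → Set
S ≈S T = (ctx S ↭ ctx T) × (succ S ≡ succ T)

RuleSet : Set₁
RuleSet = List Sequent → Sequent → RulName → Set

Inst : RuleSet → RuleSet
Inst R ps c L = Σ (List Sequent) λ ps' → Σ Sequent λ c' →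
  Pointwise _≈S_ ps ps' × c ≈S c' × R ps' c' L

iGL : RuleSet
iGL = Inst GL₀

iK4 : RuleSet
iK4 = Inst K4₀

Label : Set
Label = Sequent × RulName

data FinTree : Set where
  node : Label → List FinTree → FinTree

rootLabel : FinTree → Label
rootLabel (node a _) = a

rootSeq : FinTree → Sequent
rootSeq t = proj₁ (rootLabel t)

mutual
  height : FinTree → ℕ
  height (node _ ts) = heightL ts

  heightL : List FinTree → ℕ
  heightL []       = 0
  heightL (t ∷ ts) = suc (height t) ⊔ heightL ts

data IsProof (R : RuleSet) : FinTree → Set where
  mk : ∀ {S L ts} → R (map rootSeq ts) S L → All (IsProof R) ts →
       IsProof R (node (S , L) ts)

-- Possibly infinite, finitely branching, ordered trees with labels in
-- Label, represented by their node-labelling: a tree t assigns to every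
-- finite sequence s of naturals  just a  if s is a node of t with label a,
-- and nothing otherwise.  (Element of the final coalgebra of
-- X ↦ Label × X*, described extensionally; equality of trees is
-- pointwise equality _≐_ of labellings.)
Tree : Set
Tree = List ℕ → Maybe Label

_≐_ : Tree → Tree → Set
t ≐ u = ∀ s → t s ≡ u s

_!!_ : {A : Set} → List A → ℕ → Maybe A
[]       !! _     = nothing
(x ∷ xs) !! zero  = just x
(x ∷ xs) !! suc n = xs !! n

IsNode : List ℕ → Tree → Set
IsNode s t = ∃ λ a → t s ≡ just a

subtree : List ℕ → Tree → Tree
subtree s t u = t (s ++ u)

Translation : Set
Translation = FinTree → Label × List FinTree

record IsInfTrans (β : Translation) : Set where
  field
    premisesProofs : ∀ π → IsProof iGL π → All (IsProof iGL) (proj₂ (β π))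
    localRule      : ∀ π → IsProof iGL π →
      iK4 (map (λ ι → proj₁ (proj₁ (β ι))) (proj₂ (β π)))
          (proj₁ (proj₁ (β π))) (proj₂ (proj₁ (β π)))
    heightDecr     : ∀ π → IsProof iGL π → proj₂ (proj₁ (β π)) ≢ RK4 →
      All (λ ι → height ι < height π) (proj₂ (β π))

-- trans_β, defined by recursion on the node: it is the (unique) tree with
-- trans β t = node (a , [trans β t₀ , … , trans β tₙ₋₁]) when β t = (a , [t₀ … tₙ₋₁]).
trans : Translation → FinTree → Tree
trans β t []      = just (proj₁ (β t))
trans β t (i ∷ s) = maybe (λ t' → trans β t' s) nothing (proj₂ (β t) !! i)

prefix : (ℕ → ℕ) → ℕ → List ℕ
prefix s zero    = []
prefix s (suc n) = s zero ∷ prefix (λ m → s (suc m)) n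

module Submission where

open import Defs
open import Data.Nat using (ℕ; zero; suc; _≤_; _<_)
open import Data.Product using (_×_; _,_; proj₁; proj₂; Σ)
open import Data.List using (List; []; _∷_; _++_; _∷ʳ_; length; take; drop; lookup)
open import Data.List.Properties using (take++drop≡id; take-suc; ++-identityʳ)
open import Data.List.Relation.Unary.All using (All; _∷_)
open import Data.Fin using (fromℕ<)
open import Data.Fin.Properties using (toℕ-fromℕ<)
open import Data.Maybe using (Maybe; just; nothing; maybe; fromMaybe; _>>=_)
open import Relation.Binary.PropositionalEquality
  using (_≡_; refl; sym; cong; subst; module ≡-Reasoning)
  renaming (trans to ≡-trans)

-- The tree trans β π is unfolded from π one β-step at a time, so every node s of it
-- is reached by following s through the finite proofs β produces: the subtree at s is
-- trans β ι for the proof ι found at the end of that path, and each step of the path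
-- selects a child in the list component of β.  Proofhood is preserved along the path
-- because β sends finite proofs to lists of finite proofs.

All-!! : ∀ {A : Set} {P : A → Set} {xs x} i → All P xs → xs !! i ≡ just x → P x
All-!! zero    (px ∷ _)   refl = px
All-!! (suc i) (_  ∷ pxs) eq   = All-!! i pxs eq

just-fromMaybe : ∀ {A B : Set} {d : A} {f : A → Maybe B} {b} (m : Maybe A) →
  maybe f nothing m ≡ just b → m ≡ just (fromMaybe d m)
just-fromMaybe (just _) _ = refl

prefix-suc : ∀ (s : ℕ → ℕ) n → prefix s (suc n) ≡ prefix s n ∷ʳ s n
prefix-suc s zero    = refl
prefix-suc s (suc n) = cong (s zero ∷_) (prefix-suc (λ m → s (suc m)) n)

take-suc-fromℕ< : ∀ (s : List ℕ) n (n<k : n < length s) →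
  take (suc n) s ≡ take n s ∷ʳ lookup s (fromℕ< n<k)
take-suc-fromℕ< s n n<k = subst (λ m → take (suc m) s ≡ take m s ∷ʳ lookup s (fromℕ< n<k))
  (toℕ-fromℕ< n<k) (take-suc s (fromℕ< n<k))

module _ (β : Translation) where

  children : FinTree → List FinTree
  children t = proj₂ (β t)

  follow : List ℕ → FinTree → Maybe FinTree
  follow []      t = just t
  follow (i ∷ p) t = children t !! i >>= follow p

  trans-++ : ∀ p u t →
    trans β t (p ++ u) ≡ maybe (λ t′ → trans β t′ u) nothing (follow p t)
  trans-++ []      u t = refl
  trans-++ (i ∷ p) u t with children t !! i
  ... | just t′ = trans-++ p u t′
  ... | nothing = refl

  follow-∷ʳ : ∀ p i t → follow (p ∷ʳ i) t ≡ (follow p t >>= λ t′ → children t′ !! i)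
  follow-∷ʳ []      i t with children t !! i
  ... | just _  = refl
  ... | nothing = refl
  follow-∷ʳ (j ∷ p) i t with children t !! j
  ... | just t′ = follow-∷ʳ p i t′
  ... | nothing = refl

  follow-isProof : IsInfTrans β → ∀ p t {t′} →
    follow p t ≡ just t′ → IsProof iGL t → IsProof iGL t′
  follow-isProof isT []      t refl t-proof = t-proof
  follow-isProof isT (i ∷ p) t eq   t-proof with children t !! i in child
  ... | just t′ = follow-isProof isT p t′ eq
    (All-!! i (IsInfTrans.premisesProofs isT t t-proof) child)

  isNode-++ˡ : ∀ p u t → IsNode (p ++ u) (trans β t) → IsNode p (trans β t)
  isNode-++ˡ []      u t _    = proj₁ (β t) , refl
  isNode-++ˡ (i ∷ p) u t p++u∈t with children t !! i
  ... | just t′ = isNode-++ˡ p u t′ p++u∈t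

  isNode-take : ∀ n s t → IsNode s (trans β t) → IsNode (take n s) (trans β t)
  isNode-take n s t s∈t =
    isNode-++ˡ (take n s) (drop n s) t
      (subst (λ p → IsNode p (trans β t)) (sym (take++drop≡id n s)) s∈t)

  module _ (t : FinTree) where

    -- Off the nodes of trans β t the value t is junk; every lemma below assumes a node.
    proofAt : List ℕ → FinTree
    proofAt p = fromMaybe t (follow p t)

    follow-node : ∀ p → IsNode p (trans β t) → follow p t ≡ just (proofAt p)
    follow-node p (a , p-label) = just-fromMaybe (follow p t) (begin
      maybe (λ t′ → trans β t′ []) nothing (follow p t) ≡⟨ sym (trans-++ p [] t) ⟩
      trans β t (p ++ [])                                ≡⟨ cong (trans β t) (++-identityʳ p) ⟩
      trans β t p                                        ≡⟨ p-label ⟩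
      just a                                             ∎)
      where open ≡-Reasoning

    proofAt-isProof : IsInfTrans β → ∀ p → IsNode p (trans β t) →
      IsProof iGL t → IsProof iGL (proofAt p)
    proofAt-isProof isT p p∈t = follow-isProof isT p t (follow-node p p∈t)

    subtree-proofAt : ∀ p → IsNode p (trans β t) →
      subtree p (trans β t) ≐ trans β (proofAt p)
    subtree-proofAt p p∈t u =
      ≡-trans (trans-++ p u t) (cong (maybe (λ t′ → trans β t′ u) nothing) (follow-node p p∈t))

    children-proofAt : ∀ p i {q} → q ≡ p ∷ʳ i → IsNode p (trans β t) → IsNode q (trans β t) →
      children (proofAt p) !! i ≡ just (proofAt q)
    children-proofAt p i refl p∈t q∈t = begin
      children (proofAt p) !! i                ≡⟨ cong (_>>= λ t′ → children t′ !! i) (follow-node p p∈t) ⟨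
      (follow p t >>= λ t′ → children t′ !! i) ≡⟨ follow-∷ʳ p i t ⟨
      follow (p ∷ʳ i) t                        ≡⟨ follow-node (p ∷ʳ i) q∈t ⟩
      just (proofAt (p ∷ʳ i))                  ∎
      where open ≡-Reasoning

mainTheorem2 : (β : Translation) → IsInfTrans β → (π : FinTree) → IsProof iGL π →
    ((s : List ℕ) → IsNode s (trans β π) →
      Σ (ℕ → FinTree) λ ι →
        ((n : ℕ) → n ≤ length s →
          IsProof iGL (ι n) × subtree (take n s) (trans β π) ≐ trans β (ι n))
        × ((n : ℕ) → (n<k : n < length s) →
          proj₂ (β (ι n)) !! lookup s (fromℕ< n<k) ≡ just (ι (suc n))))
    × ((s : ℕ → ℕ) → ((n : ℕ) → IsNode (prefix s n) (trans β π)) →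
      Σ (ℕ → FinTree) λ ι → (n : ℕ) →
        IsProof iGL (ι n) × subtree (prefix s n) (trans β π) ≐ trans β (ι n)
        × proj₂ (β (ι n)) !! s n ≡ just (ι (suc n)))
mainTheorem2 β isT π π-proof =
  (λ s s∈π → (λ n → proofAt β π (take n s)) ,
    (λ n _ → proofAt-isProof β π isT (take n s) (isNode-take β n s π s∈π) π-proof ,
             subtree-proofAt β π (take n s) (isNode-take β n s π s∈π)) ,
    (λ n n<k → children-proofAt β π (take n s) _ (take-suc-fromℕ< s n n<k)
                 (isNode-take β n s π s∈π) (isNode-take β (suc n) s π s∈π))) ,
  (λ s prefix∈π → (λ n → proofAt β π (prefix s n)) , λ n →
    proofAt-isProof β π isT (prefix s n) (prefix∈π n) π-proof ,
    subtree-proofAt β π (prefix s n) (prefix∈π n) ,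
    children-proofAt β π (prefix s n) (s n) (prefix-suc s n) (prefix∈π n) (prefix∈π (suc n)))
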